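{- Let $\mathcal{X}=(X,\leq,\top,\ominus)$ and $\mathcal{Y}=(Y,\preceq,\uparrow,\boxminus)$ be D-posets and let $f:X\to Y$ be a generalized D-monotonic function. Then the assignment $\mathbb{B}f$ sending an object $x$ of $\mathbb{B}\mathcal{X}$ to $f(x)$ and a morphism $(x,\phi,y)$ of $\mathbb{B}\mathcal{X}$ to $(f(x),f(\phi),f(y))$ is a well-defined functor $\mathbb{B}f:\mathbb{B}\mathcal{X}\to\mathbb{B}\mathcal{Y}$. Consequently $\mathbb{B}$ is a functor from the category $\mathbf{gDPos}$ of D-posets and generalized D-monotonic functions to the category $\mathbf{Cat}$ of categories and functors.
   Context: A D-poset $(X,\leq,\top,\ominus)$ is a poset with top element $\top$ and a partial binary operation $\ominus$ such that: (1) $y\ominus x$ is defined precisely when $x\leq y$; (2) whenever $x\leq y$, $y\ominus x\leq y$ and $y\ominus(y\ominus x)=x$; (3) if $z\leq y\leq x$ then $x\ominus y\leq x\ominus z$ and $(x\ominus z)\ominus(x\ominus y)=y\ominus z$. Its bottom element is $\bot:=x\ominus x$, and its canonical effect algebra sum is: $a\oplus b$ is defined iff there is $c$ with $c\ominus b=a$, and then $a\oplus b:=c$. A function $f:X\to Y$ between D-posets is generalized D-monotonic if it is monotone and $f(y\ominus x)=f(y)\boxminus f(x)$ whenever $x\leq y$ (preservation of the top element is not required). For a D-poset $\mathcal{X}$, the category $\mathbb{B}\mathcal{X}$ has objects the elements of $X$, hom-sets $\mathbb{B}\mathcal{X}[x,y]=\{x\}\times\{t\in X:t\leq y\ominus x\}\times\{y\}$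 if $x\leq y$ and $\emptyset$ otherwise, identities $(x,\bot,x)$, and composition $(y,\phi,z)\circ(x,\psi,y)=(x,\phi\oplus\psi,z)$. -}

module Defs where

open import Level using (0ℓ)
open import Data.Product using (Σ; _×_; _,_)
open import Relation.Binary.PropositionalEquality using (_≡_)
open import Relation.Binary.Structures using (IsPartialOrder)

-- A D-poset.  The partial difference  y ⊖ x  is encoded as a total
-- function whose values are only ever used (and only constrained) when
-- x ≤ y, i.e. exactly on its domain of definition.
record DPoset : Set₁ where
  infix 4 _≤_
  infixl 6 _⊖_
  field
    Carrier : Set
    _≤_     : Carrier → Carrier → Set
    isPartialOrder : IsPartialOrder _≡_ _≤_
    ⊤       : Carrier
    ≤-⊤     : ∀ x → x ≤ ⊤
    _⊖_     : Carrier → Carrier → Carrier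
    ⊖-≤     : ∀ {x y} → x ≤ y → y ⊖ x ≤ y
    ⊖-invol : ∀ {x y} → x ≤ y → y ⊖ (y ⊖ x) ≡ x
    ⊖-antitone : ∀ {x y z} → z ≤ y → y ≤ x → x ⊖ y ≤ x ⊖ z
    ⊖-⊖        : ∀ {x y z} → z ≤ y → y ≤ x → (x ⊖ z) ⊖ (x ⊖ y) ≡ y ⊖ z

  -- bottom element  ⊥ := x ⊖ x  (taken with x = ⊤)
  ⊥ : Carrier
  ⊥ = ⊤ ⊖ ⊤

  -- canonical effect-algebra sum, as a (functional) relation:
  -- IsSum a b c  means  "a ⊕ b is defined and equals c",
  -- i.e. c ⊖ b is defined (b ≤ c) and c ⊖ b = a.
  IsSum : Carrier → Carrier → Carrier → Set
  IsSum a b c = b ≤ c × c ⊖ b ≡ a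

  -- raw triples (x , φ , y), candidates for morphisms of 𝔹𝒳
  Triple : Set
  Triple = Carrier × Carrier × Carrier

  IsMor : Triple → Set
  IsMor (x , φ , y) = x ≤ y × φ ≤ y ⊖ x

  idMor : Carrier → Triple
  idMor x = (x , ⊥ , x)

  -- Composite k = m ∘ n  for  m = (y , φ , z), n = (x , ψ , y):
  -- k = (x , φ ⊕ ψ , z)
  IsComp : Triple → Triple → Triple → Set
  IsComp (y , φ , z) (x , ψ , y') (x' , χ , z') =
    y' ≡ y × x' ≡ x × z' ≡ z × IsSum φ ψ χ

open DPoset public

-- generalized D-monotonic functions (top not required to be preserved)
record GenDMono (X Y : DPoset) (f : Carrier X → Carrier Y) : Set where
  field
    mono    : ∀ {x y} → _≤_ X x y → _≤_ Y (f x) (f y)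
    pres-⊖  : ∀ {x y} → _≤_ X x y → f (_⊖_ X y x) ≡ _⊖_ Y (f y) (f x)

𝔹 : {X Y : DPoset} → (Carrier X → Carrier Y) → Triple X → Triple Y
𝔹 f (x , φ , y) = (f x , f φ , f y)

module Submission where

open import Defs using (DPoset; Carrier; Triple; IsMor; IsSum; IsComp; idMor; GenDMono; 𝔹)
open import Data.Product using (_×_; _,_)
open import Function using (_∘_; id)
open import Relation.Binary.Bundles using (Poset)
open import Relation.Binary.PropositionalEquality using (_≡_; refl; sym; trans; cong; subst)
open import Relation.Binary.Structures using (IsPartialOrder)
import Relation.Binary.Reasoning.PartialOrder as ≤-Reasoning

module DPosetProperties (X : DPoset) where
  open DPoset X
  open IsPartialOrder isPartialOrder using (antisym) renaming (refl to ≤-refl)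

  poset : Poset _ _ _
  poset = record { isPartialOrder = isPartialOrder }

  open ≤-Reasoning poset

  ⊥-≤ : ∀ x → ⊥ ≤ x
  ⊥-≤ x = begin
    ⊤ ⊖ ⊤        ≤⟨ ⊖-antitone (≤-⊤ (⊤ ⊖ x)) ≤-refl ⟩
    ⊤ ⊖ (⊤ ⊖ x)  ≡⟨ ⊖-invol (≤-⊤ x) ⟩
    x            ∎

  x⊖⊥≡x : ∀ x → x ⊖ ⊥ ≡ x
  x⊖⊥≡x x = antisym (⊖-≤ (⊥-≤ x)) (begin
    x            ≡⟨ sym (⊖-invol ≤-refl) ⟩
    x ⊖ (x ⊖ x)  ≤⟨ ⊖-antitone (⊥-≤ (x ⊖ x)) (⊖-≤ ≤-refl) ⟩
    x ⊖ ⊥        ∎)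

  x⊖x≡⊥ : ∀ x → x ⊖ x ≡ ⊥
  x⊖x≡⊥ x = begin-equality
    x ⊖ x        ≡⟨ cong (x ⊖_) (sym (x⊖⊥≡x x)) ⟩
    x ⊖ (x ⊖ ⊥)  ≡⟨ ⊖-invol (⊥-≤ x) ⟩
    ⊥            ∎

module GenDMonoProperties {X Y : DPoset} {f : Carrier X → Carrier Y} (gd : GenDMono X Y f) where
  open GenDMono gd
  open IsPartialOrder (DPoset.isPartialOrder X) using () renaming (refl to ≤-refl)

  -- Although ⊤ need not be preserved, ⊥ = ⊤ ⊖ ⊤ is.
  pres-⊥ : f (DPoset.⊥ X) ≡ DPoset.⊥ Y
  pres-⊥ = trans (pres-⊖ ≤-refl) (DPosetProperties.x⊖x≡⊥ Y (f (DPoset.⊤ X)))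

  pres-IsSum : ∀ {a b c} → IsSum X a b c → IsSum Y (f a) (f b) (f c)
  pres-IsSum (b≤c , c⊖b≡a) = mono b≤c , trans (sym (pres-⊖ b≤c)) (cong f c⊖b≡a)

  pres-IsMor : ∀ m → IsMor X m → IsMor Y (𝔹 {X} {Y} f m)
  pres-IsMor (x , φ , y) (x≤y , φ≤y⊖x) =
    mono x≤y , subst (DPoset._≤_ Y (f φ)) (pres-⊖ x≤y) (mono φ≤y⊖x)

  pres-idMor : ∀ x → 𝔹 {X} {Y} f (idMor X x) ≡ idMor Y (f x)
  pres-idMor x = cong (λ φ → f x , φ , f x) pres-⊥

  pres-IsComp : ∀ m n k → IsComp X m n k → IsComp Y (𝔹 {X} {Y} f m) (𝔹 {X} {Y} f n) (𝔹 {X} {Y} f k)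
  pres-IsComp _ _ _ (y'≡y , x'≡x , z'≡z , sum) =
    cong f y'≡y , cong f x'≡x , cong f z'≡z , pres-IsSum sum

𝔹-id : (X : DPoset) (m : Triple X) → 𝔹 {X} {X} id m ≡ m
𝔹-id X m = refl

𝔹-∘ : (X Y Z : DPoset) (f : Carrier X → Carrier Y) (g : Carrier Y → Carrier Z)
      (m : Triple X) → 𝔹 {X} {Z} (g ∘ f) m ≡ 𝔹 {Y} {Z} g (𝔹 {X} {Y} f m)
𝔹-∘ X Y Z f g m = refl

mainTheorem3 :
    ((X Y : DPoset) (f : Carrier X → Carrier Y) → GenDMono X Y f →
       ((m : Triple X) → IsMor X m → IsMor Y (𝔹 {X} {Y} f m))
     × ((x : Carrier X) → 𝔹 {X} {Y} f (idMor X x) ≡ idMor Y (f x))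
     × ((m n k : Triple X) → IsMor X m → IsMor X n → IsComp X m n k →
          IsComp Y (𝔹 {X} {Y} f m) (𝔹 {X} {Y} f n) (𝔹 {X} {Y} f k)))
  × ((X : DPoset) → (m : Triple X) → 𝔹 {X} {X} id m ≡ m)
  × ((X Y Z : DPoset) (f : Carrier X → Carrier Y) (g : Carrier Y → Carrier Z) →
       GenDMono X Y f → GenDMono Y Z g →
       (m : Triple X) → 𝔹 {X} {Z} (g ∘ f) m ≡ 𝔹 {Y} {Z} g (𝔹 {X} {Y} f m))
mainTheorem3 =
    (λ X Y f gd → let open GenDMonoProperties gd in
       pres-IsMor , pres-idMor , λ m n k _ _ → pres-IsComp m n k)
  , 𝔹-id
  , λ X Y Z f g _ _ → 𝔹-∘ X Y Z f g
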